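{- Let $A$ be a finite set of actions partitioned as $A=A^l\uplus A^r$, with $\mathcal{L}$ and satisfaction over $\mathcal{P}$ as in the context. Every formula $\phi\in\mathcal{L}$ is logically equivalent (satisfied by exactly the same processes of $\mathcal{P}$) to a formula in strong normal form whose modal depth is at most that of $\phi$.
   Context: Process terms over $A$ are given by $p::=0\mid\omega\mid a.p\mid p+p$ with $a\in A$; the set of process terms is $\mathcal{P}$. Their transitions are the least relation satisfying: $\omega\xrightarrow{b}\omega$ for every $b\in A^l$; $a.p\xrightarrow{a}p$ for every $a\in A$; if $p\xrightarrow{a}p'$ then $p+q\xrightarrow{a}p'$ and $q+p\xrightarrow{a}p'$. The logic $\mathcal{L}$ has syntax $\varphi::=\bot\mid\top\mid\varphi\land\varphi\mid\varphi\lor\varphi\mid[b]\varphi\mid\langle a\rangle\varphi$ with $a\in A^r$, $b\in A^l$; $\bot,\top,\land,\lor$ have the usual meaning, $p\models[b]\varphi$ iff $p'\models\varphi$ for all $p\xrightarrow{b}p'$, and $p\models\langle a\rangle\varphi$ iff $p'\models\varphi$ for some $p\xrightarrow{a}p'$. The modal depth of a formula is the maximal nesting of modal operators $[b]$, $\langle a\rangle$ in it. Strong normal forms and unary strong normal forms are defined by simultaneous induction: a strong normal form is a finite (possibly empty, giving $\bot$) disjunction $\bigvee_{i\in I}\phi_i$ of unary strong normal forms; a unary strong normal form is either $\top$ or a formula $\bigwedge_{j\in J}\langle a_j\rangle\phi_j\land\bigwedge_{b\in A^l}[b]\psi_b$ with $J$ finite, $a_j\in A^r$, each $\phi_j$ a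 unary strong normal form and each $\psi_b$ a strong normal form. -}

module Defs where

open import Data.Nat using (ℕ; zero; suc; _⊔_; _≤_)
open import Data.Fin using (Fin)
open import Data.Sum using (_⊎_; inj₁; inj₂)
open import Data.Product using (_×_; _,_; proj₁; proj₂; Σ; ∃)
open import Data.List using (List; []; _∷_; foldr; map)
open import Data.List.Relation.Unary.All using (All)
open import Data.Empty using () renaming (⊥ to Empty)
open import Data.Unit using () renaming (⊤ to Unit)
open import Data.List using (allFin) public

module Actions (nl nr : ℕ) where

  Al : Set
  Al = Fin nl

  Ar : Set
  Ar = Fin nr

  A : Set
  A = Al ⊎ Ar

  data Proc : Set where
    𝟘   : Proc
    ω   : Proc
    _∙_ : A → Proc → Proc
    _⊕_ : Proc → Proc → Proc

  infixr 6 _∙_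
  infixl 5 _⊕_

  data _─_⟶_ : Proc → A → Proc → Set where
    ω-loop : (b : Al) → ω ─ inj₁ b ⟶ ω
    pref   : (a : A) (p : Proc) → (a ∙ p) ─ a ⟶ p
    sumL   : ∀ {p a p'} (q : Proc) → p ─ a ⟶ p' → (p ⊕ q) ─ a ⟶ p'
    sumR   : ∀ {p a p'} (q : Proc) → p ─ a ⟶ p' → (q ⊕ p) ─ a ⟶ p'

  data Form : Set where
    ff  : Form
    tt  : Form
    _∧_ : Form → Form → Form
    _∨_ : Form → Form → Form
    box : Al → Form → Form
    dia : Ar → Form → Form

  _⊨_ : Proc → Form → Set
  p ⊨ ff = Empty
  p ⊨ tt = Unit
  p ⊨ (φ ∧ ψ) = (p ⊨ φ) × (p ⊨ ψ)
  p ⊨ (φ ∨ ψ) = (p ⊨ φ) ⊎ (p ⊨ ψ)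
  p ⊨ box b φ = ∀ p' → p ─ inj₁ b ⟶ p' → p' ⊨ φ
  p ⊨ dia a φ = Σ Proc λ p' → (p ─ inj₂ a ⟶ p') × (p' ⊨ φ)

  depth : Form → ℕ
  depth ff = zero
  depth tt = zero
  depth (φ ∧ ψ) = depth φ ⊔ depth ψ
  depth (φ ∨ ψ) = depth φ ⊔ depth ψ
  depth (box b φ) = suc (depth φ)
  depth (dia a φ) = suc (depth φ)

  _≡ₗ_ : Form → Form → Set
  φ ≡ₗ ψ = ∀ (p : Proc) → ((p ⊨ φ) → (p ⊨ ψ)) × ((p ⊨ ψ) → (p ⊨ φ))

  ⋁ : List Form → Form
  ⋁ = foldr _∨_ ff

  ⋀ : List Form → Form
  ⋀ = foldr _∧_ tt

  unaryShape : List (Ar × Form) → (Al → Form) → Form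
  unaryShape ds ψ =
    ⋀ (map (λ d → dia (proj₁ d) (proj₂ d)) ds) ∧ ⋀ (map (λ b → box b (ψ b)) (allFin nl))

  data SNF  : Form → Set
  data USNF : Form → Set

  data SNF where
    snf : (φs : List Form) → All USNF φs → SNF (⋁ φs)

  data USNF where
    usnf-⊤    : USNF tt
    usnf-conj : (ds : List (Ar × Form)) → All (λ d → USNF (proj₂ d)) ds →
                (ψ : Al → Form) → (∀ b → SNF (ψ b)) → USNF (unaryShape ds ψ)

module Submission where

-- Write  NF n φ  for "φ has an equivalent strong normal form of depth ≤ n"; the theorem
-- says NF (depth φ) φ, proved by induction on φ.  NF is invariant under logical
-- equivalence, so each connective reduces to an operation on normal forms:
--   * ∨ : concatenate the lists of disjuncts;
--   * ∧ : distribute over the disjuncts, and conjoin two unary normal forms by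
--         concatenating their diamond lists and conjoining their box components b by b
--         (a recursion through the mutual structure of SNF/USNF);
--   * ⟨a⟩ : distribute over the disjuncts; ⟨a⟩x is the unary form with the single
--         diamond ⟨a⟩x and all boxes trivial;
--   * [b] : [b]α is the unary form with no diamonds, box component α at b and ⊤ elsewhere.
-- "Distribute over the disjuncts" is one lemma (lift-⋁) for any operation that
-- commutes with finite disjunctions.

open import Defs
open import Data.Nat using (ℕ; _≤_; suc; _⊔_; s≤s; z≤n)
open import Data.Nat.Properties using (⊔-lub; m≤m⊔n; m≤n⊔m; m⊔n≤o⇒m≤o; m⊔n≤o⇒n≤o; ≤-trans)
open import Data.Product using (Σ; _×_; _,_; proj₁; proj₂)
open import Data.Sum using (_⊎_; inj₁; inj₂)
open import Data.List using (List; []; _∷_; _++_; map; foldr)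
open import Data.List.Relation.Unary.All using (All; []; _∷_)
import Data.List.Relation.Unary.All as All
open import Data.List.Relation.Unary.All.Properties using (++⁺; ++⁻; map⁺; map⁻; tabulate⁺; tabulate⁻)
open import Data.Fin using (_≟_)
open import Data.Empty using (⊥-elim)
open import Data.Unit using (tt)
open import Relation.Nullary using (yes; no)
open import Relation.Binary.PropositionalEquality using (refl)

_⟺_ : Set → Set → Set
P ⟺ Q = (P → Q) × (Q → P)

⟺-refl : {P : Set} → P ⟺ P
⟺-refl = (λ h → h) , (λ h → h)

⟺-sym : {P Q : Set} → P ⟺ Q → Q ⟺ P
⟺-sym (f , f⁻) = f⁻ , f

⟺-trans : {P Q R : Set} → P ⟺ Q → Q ⟺ R → P ⟺ R
⟺-trans (f , f⁻) (g , g⁻) = (λ p → g (f p)) , (λ r → f⁻ (g⁻ r))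

×-⟺ : {P P' Q Q' : Set} → P ⟺ P' → Q ⟺ Q' → (P × Q) ⟺ (P' × Q')
×-⟺ (f , f⁻) (g , g⁻) = (λ { (p , q) → f p , g q }) , (λ { (p , q) → f⁻ p , g⁻ q })

⊔-≤ : ∀ {m n o} → (m ⊔ n ≤ o) ⟺ ((m ≤ o) × (n ≤ o))
⊔-≤ {m} {n} = (λ h → m⊔n≤o⇒m≤o m n h , m⊔n≤o⇒n≤o m n h) , (λ { (h , h') → ⊔-lub h h' })

module Normalisation (nl nr : ℕ) where
  open Actions nl nr

  ≡ₗ-trans : ∀ {φ ψ χ} → φ ≡ₗ ψ → ψ ≡ₗ χ → φ ≡ₗ χ
  ≡ₗ-trans e e' p = ⟺-trans (e p) (e' p)

  ≡ₗ-sym : ∀ {φ ψ} → φ ≡ₗ ψ → ψ ≡ₗ φ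
  ≡ₗ-sym e p = ⟺-sym (e p)

  ∧-cong : ∀ {φ φ' ψ ψ'} → φ ≡ₗ φ' → ψ ≡ₗ ψ' → (φ ∧ ψ) ≡ₗ (φ' ∧ ψ')
  ∧-cong e e' p = ×-⟺ (e p) (e' p)

  ∨-cong : ∀ {φ φ' ψ ψ'} → φ ≡ₗ φ' → ψ ≡ₗ ψ' → (φ ∨ ψ) ≡ₗ (φ' ∨ ψ')
  ∨-cong e e' p = (λ { (inj₁ h) → inj₁ (proj₁ (e p) h) ; (inj₂ h) → inj₂ (proj₁ (e' p) h) })
                , (λ { (inj₁ h) → inj₁ (proj₂ (e p) h) ; (inj₂ h) → inj₂ (proj₂ (e' p) h) })

  box-cong : ∀ b {φ ψ} → φ ≡ₗ ψ → box b φ ≡ₗ box b ψ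
  box-cong b e p = (λ h p' t → proj₁ (e p') (h p' t)) , (λ h p' t → proj₂ (e p') (h p' t))

  dia-cong : ∀ a {φ ψ} → φ ≡ₗ ψ → dia a φ ≡ₗ dia a ψ
  dia-cong a e p = (λ { (p' , t , h) → p' , t , proj₁ (e p') h })
                 , (λ { (p' , t , h) → p' , t , proj₂ (e p') h })

  ∧-identityˡ : ∀ φ → (tt ∧ φ) ≡ₗ φ
  ∧-identityˡ φ p = proj₂ , (λ h → tt , h)

  ∧-identityʳ : ∀ φ → (φ ∧ tt) ≡ₗ φ
  ∧-identityʳ φ p = proj₁ , (λ h → h , tt)

  ∨-identityʳ : ∀ φ → φ ≡ₗ (φ ∨ ff)
  ∨-identityʳ φ p = inj₁ , λ { (inj₁ h) → h }

  ∧-zeroˡ : ∀ φ → (ff ∧ φ) ≡ₗ ff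
  ∧-zeroˡ φ p = proj₁ , λ ()

  ∧-zeroʳ : ∀ φ → (φ ∧ ff) ≡ₗ ff
  ∧-zeroʳ φ p = proj₂ , λ ()

  ∧-distribʳ-∨ : ∀ φ ψ χ → ((φ ∨ ψ) ∧ χ) ≡ₗ ((φ ∧ χ) ∨ (ψ ∧ χ))
  ∧-distribʳ-∨ φ ψ χ p = (λ { (inj₁ h , k) → inj₁ (h , k) ; (inj₂ h , k) → inj₂ (h , k) })
                       , (λ { (inj₁ (h , k)) → inj₁ h , k ; (inj₂ (h , k)) → inj₂ h , k })

  ∧-distribˡ-∨ : ∀ φ ψ χ → (φ ∧ (ψ ∨ χ)) ≡ₗ ((φ ∧ ψ) ∨ (φ ∧ χ))
  ∧-distribˡ-∨ φ ψ χ p = (λ { (h , inj₁ k) → inj₁ (h , k) ; (h , inj₂ k) → inj₂ (h , k) })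
                       , (λ { (inj₁ (h , k)) → h , inj₁ k ; (inj₂ (h , k)) → h , inj₂ k })

  dia-zero : ∀ a → dia a ff ≡ₗ ff
  dia-zero a p = (λ { (_ , _ , ()) }) , λ ()

  dia-distrib-∨ : ∀ a φ ψ → dia a (φ ∨ ψ) ≡ₗ (dia a φ ∨ dia a ψ)
  dia-distrib-∨ a φ ψ p = (λ { (p' , t , inj₁ h) → inj₁ (p' , t , h) ; (p' , t , inj₂ h) → inj₂ (p' , t , h) })
                        , (λ { (inj₁ (p' , t , h)) → p' , t , inj₁ h ; (inj₂ (p' , t , h)) → p' , t , inj₂ h })

  box-distrib-∧ : ∀ {p} b φ ψ → (p ⊨ box b (φ ∧ ψ)) ⟺ ((p ⊨ box b φ) × (p ⊨ box b ψ))
  box-distrib-∧ b φ ψ = (λ h → (λ p' t → proj₁ (h p' t)) , (λ p' t → proj₂ (h p' t)))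
                      , (λ { (h , k) p' t → h p' t , k p' t })

  ⋁-++ : ∀ xs ys → ⋁ (xs ++ ys) ≡ₗ (⋁ xs ∨ ⋁ ys)
  ⋁-++ [] ys p = inj₂ , λ { (inj₂ h) → h }
  ⋁-++ (x ∷ xs) ys p =
      (λ { (inj₁ h) → inj₁ (inj₁ h) ; (inj₂ h) → reassoc (proj₁ (⋁-++ xs ys p) h) })
    , (λ { (inj₁ (inj₁ h)) → inj₁ h
         ; (inj₁ (inj₂ h)) → inj₂ (proj₂ (⋁-++ xs ys p) (inj₁ h))
         ; (inj₂ h) → inj₂ (proj₂ (⋁-++ xs ys p) (inj₂ h)) })
    where
    reassoc : (p ⊨ ⋁ xs) ⊎ (p ⊨ ⋁ ys) → (p ⊨ (x ∨ ⋁ xs)) ⊎ (p ⊨ ⋁ ys)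
    reassoc (inj₁ h) = inj₁ (inj₂ h)
    reassoc (inj₂ h) = inj₂ h

  ⋀-sat : ∀ {p} xs → (p ⊨ ⋀ xs) ⟺ All (p ⊨_) xs
  ⋀-sat [] = (λ _ → []) , (λ _ → tt)
  ⋀-sat (x ∷ xs) = (λ { (h , hs) → h ∷ proj₁ (⋀-sat xs) hs })
                 , (λ { (h ∷ hs) → h , proj₂ (⋀-sat xs) hs })

  depth-foldr : (c : Form → Form → Form) (e : Form) →
                (∀ {n} x y → (depth (c x y) ≤ n) ⟺ ((depth x ≤ n) × (depth y ≤ n))) →
                (∀ {n} → depth e ≤ n) →
                ∀ {n} xs → (depth (foldr c e xs) ≤ n) ⟺ All (λ x → depth x ≤ n) xs
  depth-foldr c e c-depth e-depth [] = (λ _ → []) , (λ _ → e-depth)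
  depth-foldr c e c-depth e-depth (x ∷ xs) =
      (λ h → let (hx , hxs) = proj₁ (c-depth x _) h in hx ∷ proj₁ (rest xs) hxs)
    , (λ { (hx ∷ hxs) → proj₂ (c-depth x _) (hx , proj₂ (rest xs) hxs) })
    where rest = depth-foldr c e c-depth e-depth

  depth-⋁ : ∀ {n} xs → (depth (⋁ xs) ≤ n) ⟺ All (λ x → depth x ≤ n) xs
  depth-⋁ = depth-foldr _∨_ ff (λ x y → ⊔-≤) z≤n

  depth-⋀ : ∀ {n} xs → (depth (⋀ xs) ≤ n) ⟺ All (λ x → depth x ≤ n) xs
  depth-⋀ = depth-foldr _∧_ tt (λ x y → ⊔-≤) z≤n

  Diamonds : Proc → List (Ar × Form) → Set
  Diamonds p ds = All (λ d → p ⊨ dia (proj₁ d) (proj₂ d)) ds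

  Boxes : Proc → (Al → Form) → Set
  Boxes p ψ = ∀ b → p ⊨ box b (ψ b)

  All-map : ∀ {X : Set} {P : Form → Set} (f : X → Form) xs →
            All P (map f xs) ⟺ All (λ x → P (f x)) xs
  All-map f xs = map⁻ , map⁺

  All-map-allFin : ∀ {P : Form → Set} (f : Al → Form) →
                   All P (map f (allFin nl)) ⟺ (∀ b → P (f b))
  All-map-allFin f = (λ h → tabulate⁻ (map⁻ h)) , (λ h → map⁺ (tabulate⁺ h))

  unaryShape-sat : ∀ {p} ds ψ → (p ⊨ unaryShape ds ψ) ⟺ (Diamonds p ds × Boxes p ψ)
  unaryShape-sat ds ψ =
    ×-⟺ (⟺-trans (⋀-sat _) (All-map _ ds)) (⟺-trans (⋀-sat _) (All-map-allFin _))

  unaryShape-depth : ∀ {n} ds ψ → (depth (unaryShape ds ψ) ≤ n) ⟺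
    (All (λ d → suc (depth (proj₂ d)) ≤ n) ds × (∀ b → suc (depth (ψ b)) ≤ n))
  unaryShape-depth ds ψ =
    ⟺-trans ⊔-≤ (×-⟺ (⟺-trans (depth-⋀ _) (All-map _ ds)) (⟺-trans (depth-⋀ _) (All-map-allFin _)))

  unaryShape-cong : ∀ ds ψ χ → (∀ b → ψ b ≡ₗ χ b) → unaryShape ds ψ ≡ₗ unaryShape ds χ
  unaryShape-cong ds ψ χ e p =
    ⟺-trans (unaryShape-sat ds ψ) (⟺-trans (×-⟺ ⟺-refl boxes) (⟺-sym (unaryShape-sat ds χ)))
    where
    boxes : Boxes p ψ ⟺ Boxes p χ
    boxes = (λ h b → proj₁ (box-cong b (e b) p) (h b)) , (λ h b → proj₂ (box-cong b (e b) p) (h b))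

  unaryShape-∧ : ∀ ds es ψ χ →
    (unaryShape ds ψ ∧ unaryShape es χ) ≡ₗ unaryShape (ds ++ es) (λ b → ψ b ∧ χ b)
  unaryShape-∧ ds es ψ χ p =
    ⟺-trans (×-⟺ (unaryShape-sat ds ψ) (unaryShape-sat es χ))
      (⟺-trans (to , from) (⟺-sym (unaryShape-sat (ds ++ es) (λ b → ψ b ∧ χ b))))
    where
    to : (Diamonds p ds × Boxes p ψ) × (Diamonds p es × Boxes p χ) →
         Diamonds p (ds ++ es) × Boxes p (λ b → ψ b ∧ χ b)
    to ((dψ , bψ) , (dχ , bχ)) = ++⁺ dψ dχ , λ b → proj₂ (box-distrib-∧ b (ψ b) (χ b)) (bψ b , bχ b)
    from : Diamonds p (ds ++ es) × Boxes p (λ b → ψ b ∧ χ b) →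
           (Diamonds p ds × Boxes p ψ) × (Diamonds p es × Boxes p χ)
    from (d , bs) = let (dψ , dχ) = ++⁻ ds d in
      (dψ , λ b → proj₁ (proj₁ (box-distrib-∧ b (ψ b) (χ b)) (bs b)))
      , (dχ , λ b → proj₂ (proj₁ (box-distrib-∧ b (ψ b) (χ b)) (bs b)))

  record NF (n : ℕ) (φ : Form) : Set where
    constructor mkNF
    field
      nf       : Form
      nf-snf   : SNF nf
      nf-equiv : φ ≡ₗ nf
      nf-depth : depth nf ≤ n
  open NF public

  NF-resp : ∀ {n φ φ'} → φ ≡ₗ φ' → NF n φ' → NF n φ
  NF-resp e (mkNF ψ s e' d) = mkNF ψ s (≡ₗ-trans e e') d

  NF-mono : ∀ {m n φ} → m ≤ n → NF m φ → NF n φ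
  NF-mono m≤n (mkNF ψ s e d) = mkNF ψ s e (≤-trans d m≤n)

  ⊥-NF : ∀ {n} → NF n ff
  ⊥-NF = mkNF ff (snf [] []) (λ p → ⟺-refl) z≤n

  unary-NF : ∀ {n x} → USNF x → depth x ≤ n → NF n x
  unary-NF {x = x} u d = mkNF (x ∨ ff) (snf (x ∷ []) (u ∷ [])) (∨-identityʳ x) (⊔-lub d z≤n)

  ⊤-NF : NF 0 tt
  ⊤-NF = unary-NF usnf-⊤ z≤n

  ⊤-valid : ∀ p → p ⊨ nf ⊤-NF
  ⊤-valid p = proj₁ (nf-equiv ⊤-NF p) tt

  ∨-NF : ∀ {n φ ψ} → NF n φ → NF n ψ → NF n (φ ∨ ψ)
  ∨-NF (mkNF .(⋁ xs) (snf xs uxs) e d) (mkNF .(⋁ ys) (snf ys uys) e' d') =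
    mkNF (⋁ (xs ++ ys)) (snf (xs ++ ys) (++⁺ uxs uys))
      (≡ₗ-trans (∨-cong e e') (≡ₗ-sym (⋁-++ xs ys)))
      (proj₂ (depth-⋁ (xs ++ ys)) (++⁺ (proj₁ (depth-⋁ xs) d) (proj₁ (depth-⋁ ys) d')))

  lift-⋁ : ∀ {n} (F : Form → Form) → F ff ≡ₗ ff → (∀ φ ψ → F (φ ∨ ψ) ≡ₗ (F φ ∨ F ψ)) →
           ∀ {xs} → All (λ x → NF n (F x)) xs → NF n (F (⋁ xs))
  lift-⋁ F F-ff F-∨ [] = NF-resp F-ff ⊥-NF
  lift-⋁ F F-ff F-∨ {x ∷ xs} (h ∷ hs) = NF-resp (F-∨ x (⋁ xs)) (∨-NF h (lift-⋁ F F-ff F-∨ hs))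

  -- Normal forms are closed under conjunction, by simultaneous recursion on the normal
  -- forms: conjunctions of strong normal forms distribute over the disjuncts
  -- (∧-SNF, ∧-SNF-each, ∧-USNF-each), and two unary shapes merge, their box
  -- components being conjoined recursively (∧-USNF).
  ∧-USNF : ∀ {n x y} → USNF x → USNF y → depth x ≤ n → depth y ≤ n → NF n (x ∧ y)
  ∧-SNF : ∀ {n x y} → SNF x → SNF y → depth x ≤ n → depth y ≤ n → NF n (x ∧ y)
  ∧-USNF-each : ∀ {n x ys} → USNF x → All USNF ys → depth x ≤ n → All (λ y → depth y ≤ n) ys →
                All (λ y → NF n (x ∧ y)) ys
  ∧-SNF-each : ∀ {n xs y} → All USNF xs → SNF y → All (λ x → depth x ≤ n) xs → depth y ≤ n →
               All (λ x → NF n (x ∧ y)) xs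

  ∧-USNF usnf-⊤ v dx dy = NF-resp (∧-identityˡ _) (unary-NF v dy)
  ∧-USNF u@(usnf-conj ds _ ψ _) usnf-⊤ dx dy = NF-resp (∧-identityʳ (unaryShape ds ψ)) (unary-NF u dx)
  ∧-USNF {n} (usnf-conj ds uds ψ sψ) (usnf-conj es ues χ sχ) dx dy =
    NF-resp (unaryShape-∧ ds es ψ χ)
      (NF-resp {φ = unaryShape (ds ++ es) (λ b → ψ b ∧ χ b)}
               (unaryShape-cong (ds ++ es) (λ b → ψ b ∧ χ b) merged (λ b → nf-equiv (conj b)))
        (unary-NF (usnf-conj (ds ++ es) (++⁺ uds ues) merged (λ b → nf-snf (conj b))) merged-depth))
    where
    conj : ∀ b → NF (depth (ψ b) ⊔ depth (χ b)) (ψ b ∧ χ b)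
    conj b = ∧-SNF (sψ b) (sχ b) (m≤m⊔n _ _) (m≤n⊔m _ _)
    merged : Al → Form
    merged b = nf (conj b)
    merged-depth : depth (unaryShape (ds ++ es) merged) ≤ n
    merged-depth =
      let (dds , dψ) = proj₁ (unaryShape-depth ds ψ) dx
          (des , dχ) = proj₁ (unaryShape-depth es χ) dy
      in proj₂ (unaryShape-depth (ds ++ es) merged)
           (++⁺ dds des , λ b → ≤-trans (s≤s (nf-depth (conj b))) (⊔-lub (dψ b) (dχ b)))

  ∧-SNF {y = y} (snf xs uxs) sy dx dy =
    lift-⋁ (_∧ y) (∧-zeroˡ y) (λ φ ψ → ∧-distribʳ-∨ φ ψ y)
           (∧-SNF-each uxs sy (proj₁ (depth-⋁ xs) dx) dy)

  ∧-USNF-each u [] dx [] = []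
  ∧-USNF-each u (v ∷ vs) dx (dy ∷ dys) = ∧-USNF u v dx dy ∷ ∧-USNF-each u vs dx dys

  ∧-SNF-each [] sy [] dy = []
  ∧-SNF-each {xs = x ∷ _} (u ∷ us) sy@(snf ys uys) (dx ∷ dxs) dy =
    lift-⋁ (x ∧_) (∧-zeroʳ x) (∧-distribˡ-∨ x) (∧-USNF-each u uys dx (proj₁ (depth-⋁ ys) dy))
    ∷ ∧-SNF-each us sy dxs dy

  ∧-NF : ∀ {n φ ψ} → NF n φ → NF n ψ → NF n (φ ∧ ψ)
  ∧-NF (mkNF α sα eα dα) (mkNF β sβ eβ dβ) = NF-resp (∧-cong eα eβ) (∧-SNF sα sβ dα dβ)

  -- [b]α is the unary shape without diamonds whose box components are α at b and ⊤ elsewhere.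
  boxAt : Al → Form → Al → Form
  boxAt b α b' with b' ≟ b
  ... | yes _ = α
  ... | no _ = nf ⊤-NF

  boxAt-SNF : ∀ {n} b {α} → SNF α → depth α ≤ n → ∀ b' → SNF (boxAt b α b') × depth (boxAt b α b') ≤ n
  boxAt-SNF b s d b' with b' ≟ b
  ... | yes _ = s , d
  ... | no _ = nf-snf ⊤-NF , z≤n

  box-unary : ∀ b α → box b α ≡ₗ unaryShape [] (boxAt b α)
  box-unary b α p = (λ h → proj₂ (unaryShape-sat [] (boxAt b α)) ([] , boxes h)) ,
                    (λ h → at-b (proj₂ (proj₁ (unaryShape-sat [] (boxAt b α)) h)))
    where
    boxes : p ⊨ box b α → Boxes p (boxAt b α)
    boxes h b' with b' ≟ b
    ... | yes refl = h
    ... | no _ = λ p' _ → ⊤-valid p'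
    at-b : Boxes p (boxAt b α) → p ⊨ box b α
    at-b h with h b
    ... | hb with b ≟ b
    ... | yes refl = hb
    ... | no b≢b = ⊥-elim (b≢b refl)

  box-NF : ∀ {n φ} b → NF n φ → NF (suc n) (box b φ)
  box-NF b (mkNF α s e d) =
    NF-resp (box-cong b e) (NF-resp (box-unary b α)
      (unary-NF (usnf-conj [] [] (boxAt b α) (λ b' → proj₁ (boxAt-SNF b s d b')))
                (proj₂ (unaryShape-depth [] (boxAt b α)) ([] , λ b' → s≤s (proj₂ (boxAt-SNF b s d b'))))))

  -- ⟨a⟩x is the unary shape with the single diamond ⟨a⟩x and all box components ⊤.
  ⊤-boxes : Al → Form
  ⊤-boxes _ = nf ⊤-NF

  dia-unary : ∀ a x → dia a x ≡ₗ unaryShape ((a , x) ∷ []) ⊤-boxes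
  dia-unary a x p = (λ h → proj₂ (unaryShape-sat ds ⊤-boxes) (h ∷ [] , λ _ p' _ → ⊤-valid p')) ,
                    (λ h → single (proj₁ (proj₁ (unaryShape-sat ds ⊤-boxes) h)))
    where
    ds : List (Ar × Form)
    ds = (a , x) ∷ []
    single : Diamonds p ds → p ⊨ dia a x
    single (h ∷ []) = h

  dia-USNF : ∀ {n x} a → USNF x → depth x ≤ n → NF (suc n) (dia a x)
  dia-USNF {x = x} a u d =
    NF-resp (dia-unary a x)
      (unary-NF (usnf-conj ((a , x) ∷ []) (u ∷ []) ⊤-boxes (λ _ → nf-snf ⊤-NF))
                (proj₂ (unaryShape-depth ((a , x) ∷ []) ⊤-boxes) (s≤s d ∷ [] , λ _ → s≤s z≤n)))

  dia-NF : ∀ {n φ} a → NF n φ → NF (suc n) (dia a φ)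
  dia-NF a (mkNF .(⋁ xs) (snf xs uxs) e d) =
    NF-resp (dia-cong a e)
      (lift-⋁ (dia a) (dia-zero a) (dia-distrib-∨ a)
              (All.zipWith (λ { (u , dx) → dia-USNF a u dx }) (uxs , proj₁ (depth-⋁ xs) d)))

  normalise : (φ : Form) → NF (depth φ) φ
  normalise ff = ⊥-NF
  normalise tt = ⊤-NF
  normalise (φ ∧ ψ) = ∧-NF (NF-mono (m≤m⊔n _ _) (normalise φ)) (NF-mono (m≤n⊔m _ _) (normalise ψ))
  normalise (φ ∨ ψ) = ∨-NF (NF-mono (m≤m⊔n _ _) (normalise φ)) (NF-mono (m≤n⊔m _ _) (normalise ψ))
  normalise (box b φ) = box-NF b (normalise φ)
  normalise (dia a φ) = dia-NF a (normalise φ)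

lemma14 : (nl nr : ℕ) → let open Actions nl nr in
    (φ : Form) → Σ Form (λ ψ → SNF ψ × (φ ≡ₗ ψ) × (depth ψ ≤ depth φ))
lemma14 nl nr φ = let open Normalisation nl nr; N = normalise φ in
  nf N , nf-snf N , nf-equiv N , nf-depth N
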